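{- Let $\Phi$ be a derivation in the CbN type system of $\Gamma\vdash^{(m,e)} t:L$. (1) If $t\to_{m,\mathrm{cbn}} s$ then $m\geq 1$ and there is a derivation of $\Gamma\vdash^{(m-1,e)} s:L$. (2) If $t\to_{e,\mathrm{cbn}} s$ then $e\geq 1$ and there is a derivation of $\Gamma\vdash^{(m,e-1)} s:L$.
   Context: Terms: $t,s ::= x \mid \lambda x.t \mid t\,s \mid t[x\leftarrow s]$, where $t[x\leftarrow s]$ (explicit substitution) binds $x$ in $t$; usual free variables, terms up to $\alpha$-equivalence. Contexts: substitution contexts $S ::= \langle\cdot\rangle \mid S[x\leftarrow t]$; CbN contexts $C ::= \langle\cdot\rangle \mid C\,t \mid C[x\leftarrow t]$; $C\langle t\rangle$ is plugging (may capture), $C\langle\langle t\rangle\rangle$ plugging where $C$ does not capture free variables of $t$. Root steps: $S\langle\lambda x.t\rangle s\mapsto_m S\langle t[x\leftarrow s]\rangle$ (variables bound by $S$ disjoint from $\mathrm{fv}(s)$); $C\langle\langle x\rangle\rangle[x\leftarrow t]\mapsto_e C\langle\langle t\rangle\rangle[x\leftarrow t]$. $\to_{m,\mathrm{cbn}}$ (resp. $\to_{e,\mathrm{cbn}}$) relates $C\langle t'\rangle$ to $C\langle s'\rangle$ for any CbN context $C$ when $t'\mapsto_m s'$ (resp. $\mapsto_e$). CbN types: linear types $L ::= \mathsf{normal}\mid M\to L$; multi types $M ::= [L_i]_{i\in J}$ finite multisets, $\mathbf 0$ the empty multiset, $\uplus$ union. Type contexts $\Gamma$ map variables to multi types, all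 but finitely many to $\mathbf 0$; $\mathrm{dom}(\Gamma)=\{x\mid\Gamma(x)\neq\mathbf 0\}$; $\uplus$ pointwise; $\Gamma,x:M$ means $\Gamma\uplus(x\mapsto M)$ with $x\notin\mathrm{dom}(\Gamma)$; $\Gamma\setminus\!\!\setminus x$ is $\Gamma$ with $x$ mapped to $\mathbf 0$. Rules: (ax) $x:[L]\vdash^{(0,1)} x:L$; (normal) $\vdash^{(0,0)}\lambda x.t:\mathsf{normal}$; (fun) from $\Gamma\vdash^{(m,e)} t:L$ infer $\Gamma\setminus\!\!\setminus x\vdash^{(m,e)}\lambda x.t:\Gamma(x)\to L$; (many) from $\Pi_i\vdash^{(m_i,e_i)} t:L_i$ for $i\in J$ ($J$ finite, possibly empty) infer $\biguplus_i\Pi_i\vdash^{(\sum m_i,\sum e_i)} t:[L_i]_{i\in J}$; (app) from $\Gamma\vdash^{(m,e)} t:M\to L$ and $\Pi\vdash^{(m',e')} s:M$ infer $\Gamma\uplus\Pi\vdash^{(m+m'+1,e+e')} t\,s:L$; (ES) from $\Gamma,x:M\vdash^{(m,e)} t:L$ and $\Pi\vdash^{(m',e')} s:M$ infer $\Gamma\uplus\Pi\vdash^{(m+m',e+e')} t[x\leftarrow s]:L$. -}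

module Defs where

open import Data.Nat using (ℕ; zero; suc; _+_; _∸_; _<ᵇ_; _≡ᵇ_)
open import Data.Bool using (if_then_else_)
open import Data.List using (List; []; _∷_; _++_)
open import Data.List.Relation.Binary.Permutation.Homogeneous using (Permutation)

-- Terms of the linear substitution calculus, in de Bruijn notation
-- (terms up to α-equivalence).  `lam t` binds index 0 in t;
-- `es t s` is t[x←s] and binds index 0 in t (not in s).

data Tm : Set where
  var : ℕ → Tm
  lam : Tm → Tm
  app : Tm → Tm → Tm
  es  : Tm → Tm → Tm

shift : ℕ → ℕ → Tm → Tm
shift d c (var x)   = if x <ᵇ c then var x else var (x + d)
shift d c (lam t)   = lam (shift d (suc c) t)
shift d c (app t s) = app (shift d c t) (shift d c s)
shift d c (es t s)  = es (shift d (suc c) t) (shift d c s)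

wk : ℕ → Tm → Tm
wk d t = shift d 0 t

data SCtx : Set where
  hole : SCtx
  sub  : SCtx → Tm → SCtx

plugS : SCtx → Tm → Tm
plugS hole      t = t
plugS (sub S u) t = es (plugS S t) u

depthS : SCtx → ℕ
depthS hole      = 0
depthS (sub S u) = suc (depthS S)

data CCtx : Set where
  hole : CCtx
  appL : CCtx → Tm → CCtx
  sub  : CCtx → Tm → CCtx

-- plugging C⟨t⟩ (may capture)
plugC : CCtx → Tm → Tm
plugC hole       t = t
plugC (appL C u) t = app (plugC C t) u
plugC (sub C u)  t = es (plugC C t) u

depthC : CCtx → ℕ
depthC hole       = 0
depthC (appL C u) = depthC C
depthC (sub C u)  = suc (depthC C)

-- Root steps.
-- S⟨λx.t⟩ s ↦m S⟨t[x←s]⟩ : s moves under the binders of S without capture.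
data _↦m_ : Tm → Tm → Set where
  rootm : ∀ S t s → app (plugS S (lam t)) s ↦m plugS S (es t (wk (depthS S) s))

-- C⟨⟨x⟩⟩[x←t] ↦e C⟨⟨t⟩⟩[x←t] : x is the index bound by the ES, seen under C;
-- t is weakened past x and the binders of C (no capture).
data _↦e_ : Tm → Tm → Set where
  roote : ∀ C t → es (plugC C (var (depthC C))) t ↦e es (plugC C (wk (suc (depthC C)) t)) t

data _→m_ : Tm → Tm → Set where
  ctxm : ∀ C {t s} → t ↦m s → plugC C t →m plugC C s

data _→e_ : Tm → Tm → Set where
  ctxe : ∀ C {t s} → t ↦e s → plugC C t →e plugC C s

-- CbN types.  Multi types are finite multisets, represented as lists
-- considered up to permutation (nested: the relation ≈L below).

data Lin : Set where
  normal : Lin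
  _⇒_    : List Lin → Lin → Lin

Multi : Set
Multi = List Lin

data _≈L_ : Lin → Lin → Set where
  normal : normal ≈L normal
  arr    : ∀ {M M' L L'} → Permutation _≈L_ M M' → L ≈L L' → (M ⇒ L) ≈L (M' ⇒ L')

_≈M_ : Multi → Multi → Set
M ≈M M' = Permutation _≈L_ M M'

TCtx : Set
TCtx = ℕ → Multi

_≈C_ : TCtx → TCtx → Set
Γ ≈C Δ = ∀ x → Γ x ≈M Δ x

∅ : TCtx
∅ _ = []

_⊎_ : TCtx → TCtx → TCtx
(Γ ⊎ Π) x = Γ x ++ Π x

single : ℕ → Lin → TCtx
single x L y = if y ≡ᵇ x then (L ∷ []) else []

-- Γ with the bound index 0 removed (Γ ∖∖ x, followed by unshifting)
tl : TCtx → TCtx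
tl Γ x = Γ (suc x)

-- In (fun)/(ES) the premise context Γ' plays the role of Γ , x : M with
-- x = index 0 (so M = Γ' 0 and Γ = tl Γ').

mutual
  data _⊢⟨_,_⟩_∶_ : TCtx → ℕ → ℕ → Tm → Lin → Set where
    ax     : ∀ x L → single x L ⊢⟨ 0 , 1 ⟩ var x ∶ L
    normal : ∀ t → ∅ ⊢⟨ 0 , 0 ⟩ lam t ∶ normal
    fun    : ∀ {Γ m e t L} → Γ ⊢⟨ m , e ⟩ t ∶ L → tl Γ ⊢⟨ m , e ⟩ lam t ∶ (Γ 0 ⇒ L)
    app    : ∀ {Γ Π m e m' e' t s M M' L} →
             Γ ⊢⟨ m , e ⟩ t ∶ (M ⇒ L) → Π ⊢*⟨ m' , e' ⟩ s ∶ M' → M ≈M M' →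
             (Γ ⊎ Π) ⊢⟨ suc (m + m') , e + e' ⟩ app t s ∶ L
    esub   : ∀ {Γ Π m e m' e' t s M' L} →
             Γ ⊢⟨ m , e ⟩ t ∶ L → Π ⊢*⟨ m' , e' ⟩ s ∶ M' → Γ 0 ≈M M' →
             (tl Γ ⊎ Π) ⊢⟨ m + m' , e + e' ⟩ es t s ∶ L

  data _⊢*⟨_,_⟩_∶_ : TCtx → ℕ → ℕ → Tm → Multi → Set where
    none : ∀ {t} → ∅ ⊢*⟨ 0 , 0 ⟩ t ∶ []
    more : ∀ {Γ Π m e m' e' t L M} →
           Γ ⊢⟨ m , e ⟩ t ∶ L → Π ⊢*⟨ m' , e' ⟩ t ∶ M →
           (Γ ⊎ Π) ⊢*⟨ m + m' , e + e' ⟩ t ∶ (L ∷ M)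

module Submission where

open import Defs
open import Data.Nat using (ℕ; _≤_; _∸_)
open import Data.Product using (_×_; ∃₂)

open import Algebra.Bundles using (CommutativeMonoid)
open import Data.Bool using (true; false)
open import Data.List using ([]; _∷_; _++_)
open import Data.List.Relation.Binary.Permutation.Homogeneous using (refl; prep; swap; trans)
open import Data.List.Relation.Binary.Pointwise using (Pointwise; []; _∷_)
open import Data.Nat using (zero; suc; _+_; _<_; _<ᵇ_; z≤n; s≤s)
open import Data.Nat.Properties
  using (+-identityʳ; +-suc; +-comm; +-∸-assoc; m≤n⇒m≤o+n; ≤-reflexive; m≤n⇒m≤1+n; +-commutativeSemigroup)
open import Data.Nat.Tactic.RingSolver using (solve-∀)
open import Algebra.Properties.CommutativeSemigroup +-commutativeSemigroup
  using () renaming (x∙yz≈y∙xz to +-leftComm; xy∙z≈xz∙y to +-rightComm)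
open import Data.Product using (_,_)
open import Relation.Binary.Bundles using (Setoid)
open import Relation.Binary.PropositionalEquality using (_≡_; cong)
  renaming (refl to ≡-refl; sym to ≡-sym)

mutual
  ≈L-refl : ∀ L → L ≈L L
  ≈L-refl normal  = normal
  ≈L-refl (M ⇒ L) = arr (≈M-refl M) (≈L-refl L)

  ≈M-refl : ∀ M → M ≈M M
  ≈M-refl []      = refl []
  ≈M-refl (L ∷ M) = prep (≈L-refl L) (≈M-refl M)

mutual
  ≈L-sym : ∀ {L L'} → L ≈L L' → L' ≈L L
  ≈L-sym normal    = normal
  ≈L-sym (arr p q) = arr (≈M-sym p) (≈L-sym q)

  ≈M-sym : ∀ {M M'} → M ≈M M' → M' ≈M M
  ≈M-sym (refl pw)      = refl (pointwise-sym pw)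
  ≈M-sym (prep p q)     = prep (≈L-sym p) (≈M-sym q)
  ≈M-sym (swap p p' q)  = swap (≈L-sym p') (≈L-sym p) (≈M-sym q)
  ≈M-sym (trans q q')   = trans (≈M-sym q') (≈M-sym q)

  pointwise-sym : ∀ {M M'} → Pointwise _≈L_ M M' → Pointwise _≈L_ M' M
  pointwise-sym []       = []
  pointwise-sym (p ∷ ps) = ≈L-sym p ∷ pointwise-sym ps

-- Transitivity needs no mutual recursion: permutations compose by a constructor.
≈L-trans : ∀ {L L' L''} → L ≈L L' → L' ≈L L'' → L ≈L L''
≈L-trans normal    normal      = normal
≈L-trans (arr p q) (arr p' q') = arr (trans p p') (≈L-trans q q')

linSetoid : Setoid _ _
linSetoid = record
  { Carrier       = Lin
  ; _≈_           = _≈L_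
  ; isEquivalence = record { refl = ≈L-refl _ ; sym = ≈L-sym ; trans = ≈L-trans }
  }

-- Multiset equality _≈M_ is literally the setoid permutation relation over
-- linSetoid, so the library's algebra of permutations applies to it.
open import Data.List.Relation.Binary.Permutation.Setoid.Properties linSetoid
  using (++⁺; ++-comm; ++-identityʳ; ++-assoc)
open import Data.List.Relation.Binary.Permutation.Setoid linSetoid
  using (↭-reflexive; ↭-sym; ↭-trans)
open import Data.List.Relation.Binary.Equality.Setoid linSetoid
  using (_≋_; ≋-refl; ≋-trans)

ctxSetoid : Setoid _ _
ctxSetoid = record
  { Carrier       = TCtx
  ; _≈_           = _≈C_
  ; isEquivalence = record
    { refl  = λ {Γ} x → ≈M-refl (Γ x)
    ; sym   = λ p x → ↭-sym (p x)
    ; trans = λ p q x → ↭-trans (p x) (q x)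
    }
  }

open import Algebra.Structures {A = TCtx} _≈C_ using (IsCommutativeMonoid)

⊎-isCommutativeMonoid : IsCommutativeMonoid _⊎_ ∅
⊎-isCommutativeMonoid = record
  { isMonoid = record
    { isSemigroup = record
      { isMagma = record
        { isEquivalence = Setoid.isEquivalence ctxSetoid
        ; ∙-cong        = λ p q x → ++⁺ (p x) (q x)
        }
      ; assoc = λ Γ Δ Θ x → ++-assoc (Γ x) (Δ x) (Θ x)
      }
    ; identity = (λ Γ x → ≈M-refl (Γ x)) , (λ Γ x → ++-identityʳ (Γ x))
    }
  ; comm = λ Γ Δ x → ++-comm (Γ x) (Δ x)
  }

ctxMonoid : CommutativeMonoid _ _
ctxMonoid = record { isCommutativeMonoid = ⊎-isCommutativeMonoid }

open CommutativeMonoid ctxMonoid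
  using () renaming (refl to ≈C-refl; sym to ≈C-sym; trans to ≈C-trans;
                     ∙-cong to ⊎-cong; ∙-congˡ to ⊎-congˡ; ∙-congʳ to ⊎-congʳ;
                     assoc to ⊎-assoc; identityʳ to ⊎-identityʳ)
open import Algebra.Properties.CommutativeSemigroup (CommutativeMonoid.commutativeSemigroup ctxMonoid)
  using () renaming (xy∙z≈xz∙y to ⊎-rightComm; x∙yz≈y∙xz to ⊎-leftComm; xy∙z≈y∙xz to ⊎-rotate)

tl-cong : ∀ {Γ Δ} → Γ ≈C Δ → tl Γ ≈C tl Δ
tl-cong p x = p (suc x)

≈C-pointwise : ∀ {Γ Δ} → (∀ x → Γ x ≡ Δ x) → Γ ≈C Δ
≈C-pointwise e x = ↭-reflexive (e x)

-- This is the form of the conclusion of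
-- the theorem, and the invariant carried by all lemmas below.

_⊢≈⟨_,_⟩_∶_ : TCtx → ℕ → ℕ → Tm → Lin → Set
Γ ⊢≈⟨ m , e ⟩ t ∶ L = ∃₂ λ Γ' L' → Γ' ≈C Γ × L' ≈L L × Γ' ⊢⟨ m , e ⟩ t ∶ L'

_⊢≈*⟨_,_⟩_∶_ : TCtx → ℕ → ℕ → Tm → Multi → Set
Γ ⊢≈*⟨ m , e ⟩ t ∶ M = ∃₂ λ Γ' M' → Γ' ≈C Γ × M' ≈M M × Γ' ⊢*⟨ m , e ⟩ t ∶ M'

exactly : ∀ {Γ m e t L} → Γ ⊢⟨ m , e ⟩ t ∶ L → Γ ⊢≈⟨ m , e ⟩ t ∶ L
exactly {L = L} D = _ , _ , ≈C-refl , ≈L-refl L , D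

exactly* : ∀ {Γ m e t M} → Γ ⊢*⟨ m , e ⟩ t ∶ M → Γ ⊢≈*⟨ m , e ⟩ t ∶ M
exactly* {M = M} D = _ , _ , ≈C-refl , ≈M-refl M , D

≈-resp : ∀ {Γ Γ' m e t L L'} → Γ ≈C Γ' → L ≈L L' →
         Γ ⊢≈⟨ m , e ⟩ t ∶ L → Γ' ⊢≈⟨ m , e ⟩ t ∶ L'
≈-resp p q (_ , _ , p' , q' , D) = _ , _ , ≈C-trans p' p , ≈L-trans q' q , D

≈-resp* : ∀ {Γ Γ' m e t M} → Γ ≈C Γ' → Γ ⊢≈*⟨ m , e ⟩ t ∶ M → Γ' ⊢≈*⟨ m , e ⟩ t ∶ M
≈-resp* p (_ , _ , p' , q' , D) = _ , _ , ≈C-trans p' p , q' , D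

recount : ∀ {Γ m m' e e' t L} → m ≡ m' → e ≡ e' →
          Γ ⊢≈⟨ m , e ⟩ t ∶ L → Γ ⊢≈⟨ m' , e' ⟩ t ∶ L
recount ≡-refl ≡-refl D = D

retarget : ∀ {Γ m e t t' L} → t ≡ t' → Γ ⊢≈⟨ m , e ⟩ t ∶ L → Γ ⊢≈⟨ m , e ⟩ t' ∶ L
retarget ≡-refl D = D

≈fun : ∀ {Γ m e t L} → Γ ⊢≈⟨ m , e ⟩ t ∶ L → tl Γ ⊢≈⟨ m , e ⟩ lam t ∶ (Γ 0 ⇒ L)
≈fun (_ , _ , p , q , D) = _ , _ , tl-cong p , arr (p 0) q , fun D

≈app : ∀ {Γ Π m e m' e' t s M M' L} →
       Γ ⊢≈⟨ m , e ⟩ t ∶ (M ⇒ L) → Π ⊢≈*⟨ m' , e' ⟩ s ∶ M' → M ≈M M' →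
       (Γ ⊎ Π) ⊢≈⟨ suc (m + m') , e + e' ⟩ app t s ∶ L
≈app (_ , _ , p , arr r q , D) (_ , _ , p' , r' , D') r'' =
  _ , _ , ⊎-cong p p' , q , app D D' (↭-trans r (↭-trans r'' (↭-sym r')))

≈esub : ∀ {Γ Π m e m' e' t s M' L} →
        Γ ⊢≈⟨ m , e ⟩ t ∶ L → Π ⊢≈*⟨ m' , e' ⟩ s ∶ M' → Γ 0 ≈M M' →
        (tl Γ ⊎ Π) ⊢≈⟨ m + m' , e + e' ⟩ es t s ∶ L
≈esub (_ , _ , p , q , D) (_ , _ , p' , r' , D') r =
  _ , _ , ⊎-cong (tl-cong p) p' , q , esub D D' (↭-trans (p 0) (↭-trans r (↭-sym r')))

≈more : ∀ {Γ Π m e m' e' t L M} →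
        Γ ⊢≈⟨ m , e ⟩ t ∶ L → Π ⊢≈*⟨ m' , e' ⟩ t ∶ M →
        (Γ ⊎ Π) ⊢≈*⟨ m + m' , e + e' ⟩ t ∶ (L ∷ M)
≈more (_ , _ , p , q , D) (_ , _ , p' , r' , D') = _ , _ , ⊎-cong p p' , prep q r' , more D D'

recount* : ∀ {Π m m' e e' t M} → m ≡ m' → e ≡ e' →
           Π ⊢*⟨ m , e ⟩ t ∶ M → Π ⊢*⟨ m' , e' ⟩ t ∶ M
recount* ≡-refl ≡-refl D = D

-- A many-derivation can be reorganised along any multiset equality of its
-- type (here preceded by a pointwise one, which keeps the induction on the
-- permutation structural): its components are permuted and the context is
-- re-summed accordingly.  Needed to single out the copy of the argument
-- consumed by an exponential step.
permute* : ∀ {Π m e t M N N'} → Π ⊢*⟨ m , e ⟩ t ∶ M → M ≋ N → N ≈M N' →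
           ∃₂ λ Π' K → Π' ≈C Π × K ≋ N' × Π' ⊢*⟨ m , e ⟩ t ∶ K
permute* D pw (refl pw') = _ , _ , ≈C-refl , ≋-trans pw pw' , D
permute* (more {Γ = Γ} D₁ D₂) (q ∷ pw) (prep q' r) with permute* D₂ pw r
... | _ , _ , p , pw' , D₂' = _ , _ , ⊎-congˡ {Γ} p , ≈L-trans q q' ∷ pw' , more D₁ D₂'
permute* (more {Γ = Γa} {m = ma} {e = ea} Da (more {Γ = Γb} {m = mb} {e = eb} {m' = m} {e' = e} Db D))
         (qa ∷ qb ∷ pw) (swap qa' qb' r) with permute* D pw r
... | Π' , _ , p , pw' , D' =
  Γb ⊎ (Γa ⊎ Π') , _ , ≈C-trans (⊎-leftComm Γb Γa Π') (⊎-congˡ {Γa} (⊎-congˡ {Γb} p)) ,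
  ≈L-trans qb qb' ∷ ≈L-trans qa qa' ∷ pw' ,
  recount* (+-leftComm mb ma m) (+-leftComm eb ea e) (more Db (more Da D'))
permute* D pw (trans r r') with permute* D pw r
... | _ , _ , p , pw' , D' with permute* D' pw' r'
... | _ , _ , p' , pw'' , D'' = _ , _ , ≈C-trans p' p , pw'' , D''

-- Weakening.  shift d c inserts d fresh variables at position c; on the
-- typing side this inserts d empty slots into the context at position c.

gapC : ℕ → TCtx → TCtx
gapC zero    Π x       = Π x
gapC (suc d) Π zero    = []
gapC (suc d) Π (suc x) = gapC d Π x

shiftC : ℕ → ℕ → TCtx → TCtx
shiftC d zero    Π x       = gapC d Π x
shiftC d (suc c) Π zero    = Π zero
shiftC d (suc c) Π (suc x) = shiftC d c (tl Π) x

shiftIdx : ℕ → ℕ → ℕ → ℕ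
shiftIdx d zero    x       = d + x
shiftIdx d (suc c) zero    = zero
shiftIdx d (suc c) (suc x) = suc (shiftIdx d c x)

var-injective : ∀ {x y} → var x ≡ var y → x ≡ y
var-injective ≡-refl = ≡-refl

shift-var : ∀ d c x → shift d c (var x) ≡ var (shiftIdx d c x)
shift-var d zero    x       = cong var (+-comm x d)
shift-var d (suc c) zero    = ≡-refl
shift-var d (suc c) (suc x) with x <ᵇ c | shift-var d c x
... | true  | ih = cong (λ y → var (suc y)) (var-injective ih)
... | false | ih = cong (λ y → var (suc y)) (var-injective ih)

shiftC-⊎ : ∀ d c Γ Π y → shiftC d c (Γ ⊎ Π) y ≡ (shiftC d c Γ ⊎ shiftC d c Π) y
shiftC-⊎ d zero    Γ Π y = gapC-⊎ d y
  where
  gapC-⊎ : ∀ d y → gapC d (Γ ⊎ Π) y ≡ (gapC d Γ ⊎ gapC d Π) y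
  gapC-⊎ zero    y       = ≡-refl
  gapC-⊎ (suc d) zero    = ≡-refl
  gapC-⊎ (suc d) (suc y) = gapC-⊎ d y
shiftC-⊎ d (suc c) Γ Π zero    = ≡-refl
shiftC-⊎ d (suc c) Γ Π (suc y) = shiftC-⊎ d c (tl Γ) (tl Π) y

shiftC-∅ : ∀ d c y → shiftC d c ∅ y ≡ []
shiftC-∅ d zero    y = gapC-∅ d y
  where
  gapC-∅ : ∀ d y → gapC d ∅ y ≡ []
  gapC-∅ zero    y       = ≡-refl
  gapC-∅ (suc d) zero    = ≡-refl
  gapC-∅ (suc d) (suc y) = gapC-∅ d y
shiftC-∅ d (suc c) zero    = ≡-refl
shiftC-∅ d (suc c) (suc y) = shiftC-∅ d c y

shiftC-single : ∀ d c x L y → shiftC d c (single x L) y ≡ single (shiftIdx d c x) L y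
shiftC-single d zero    x L y = gapC-single d y
  where
  gapC-single : ∀ d y → gapC d (single x L) y ≡ single (d + x) L y
  gapC-single zero    y       = ≡-refl
  gapC-single (suc d) zero    = ≡-refl
  gapC-single (suc d) (suc y) = gapC-single d y
shiftC-single d (suc c) zero    L zero    = ≡-refl
shiftC-single d (suc c) zero    L (suc y) = shiftC-∅ d c y
shiftC-single d (suc c) (suc x) L zero    = ≡-refl
shiftC-single d (suc c) (suc x) L (suc y) = shiftC-single d c x L y

shiftC-cong : ∀ d c {Γ Δ} → Γ ≈C Δ → shiftC d c Γ ≈C shiftC d c Δ
shiftC-cong d zero    p = gapC-cong d p
  where
  gapC-cong : ∀ d {Γ Δ} → Γ ≈C Δ → gapC d Γ ≈C gapC d Δ
  gapC-cong zero    p x       = p x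
  gapC-cong (suc d) p zero    = ≈M-refl []
  gapC-cong (suc d) p (suc x) = gapC-cong d p x
shiftC-cong d (suc c) p zero    = p zero
shiftC-cong d (suc c) p (suc x) = shiftC-cong d c (tl-cong p) x

≈-resp≡ : ∀ {Γ Γ' m e t L} → (∀ y → Γ' y ≡ Γ y) → Γ ⊢≈⟨ m , e ⟩ t ∶ L → Γ' ⊢≈⟨ m , e ⟩ t ∶ L
≈-resp≡ eq = ≈-resp (≈C-sym (≈C-pointwise eq)) (≈L-refl _)

≈-resp≡* : ∀ {Γ Γ' m e t M} → (∀ y → Γ' y ≡ Γ y) → Γ ⊢≈*⟨ m , e ⟩ t ∶ M → Γ' ⊢≈*⟨ m , e ⟩ t ∶ M
≈-resp≡* eq = ≈-resp* (≈C-sym (≈C-pointwise eq))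

mutual
  weaken : ∀ {Γ m e t L} → Γ ⊢⟨ m , e ⟩ t ∶ L → ∀ d c →
           shiftC d c Γ ⊢≈⟨ m , e ⟩ shift d c t ∶ L
  weaken (ax x L) d c =
    retarget (≡-sym (shift-var d c x))
      (≈-resp≡ (shiftC-single d c x L) (exactly (ax _ L)))
  weaken (normal t) d c =
    ≈-resp≡ (shiftC-∅ d c) (exactly (normal _))
  weaken (fun D) d c = ≈fun (weaken D d (suc c))
  weaken (app D D' r) d c =
    ≈-resp≡ (shiftC-⊎ d c _ _) (≈app (weaken D d c) (weaken* D' d c) r)
  weaken (esub D D' r) d c =
    ≈-resp≡ (shiftC-⊎ d c _ _) (≈esub (weaken D d (suc c)) (weaken* D' d c) r)

  weaken* : ∀ {Γ m e t M} → Γ ⊢*⟨ m , e ⟩ t ∶ M → ∀ d c →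
            shiftC d c Γ ⊢≈*⟨ m , e ⟩ shift d c t ∶ M
  weaken* none d c = ≈-resp≡* (shiftC-∅ d c) (exactly* none)
  weaken* (more D D') d c =
    ≈-resp≡* (shiftC-⊎ d c _ _) (≈more (weaken D d c) (weaken* D' d c))

weaken≈* : ∀ {Γ m e t M} → Γ ⊢≈*⟨ m , e ⟩ t ∶ M → ∀ d c →
           shiftC d c Γ ⊢≈*⟨ m , e ⟩ shift d c t ∶ M
weaken≈* (_ , _ , p , q , D) d c with weaken* D d c
... | _ , _ , p' , q' , D' = _ , _ , ≈C-trans p' (shiftC-cong d c p) , ↭-trans q' q , D'

-- Multiplicative root step, generalised over an extra weakening j of the
-- argument: the argument s, pushed under the substitution context S, is
-- typed by weakening, and the abstraction's premise becomes an (ES) premise.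
-- The counters: the (app) node disappears, everything else is kept.
↦m-typing : ∀ S j {Γ m e u M L} → Γ ⊢⟨ m , e ⟩ plugS S (lam u) ∶ (M ⇒ L) →
            ∀ {Π m' e' s M'} → Π ⊢≈*⟨ m' , e' ⟩ s ∶ M' → M ≈M M' →
            (Γ ⊎ gapC j Π) ⊢≈⟨ m + m' , e + e' ⟩ plugS S (es u (wk (depthS S + j) s)) ∶ L
↦m-typing hole j (fun D) S⊢s r = ≈esub (exactly D) (weaken≈* S⊢s j 0) r
↦m-typing (sub S v) j {u = u} (esub {Γ = Δ} {Π = Πv} {m = m₁} {e = e₁} {m' = m₂} {e' = e₂} D Dv r)
          {Π} {m'} {e'} {s} S⊢s r' =
  recount (+-rightComm m₁ m' m₂) (+-rightComm e₁ e' e₂)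
    (≈-resp (⊎-rightComm (tl Δ) (gapC j Π) Πv) (≈L-refl _)
      (≈esub (retarget (cong (λ k → plugS S (es u (wk k s))) (+-suc (depthS S) j))
                       (↦m-typing S (suc j) D S⊢s r'))
             (exactly* Dv) (↭-trans (++-identityʳ (Δ 0)) r)))

↦m-decrements : ∀ {Γ m e t t' L} → t ↦m t' → Γ ⊢⟨ m , e ⟩ t ∶ L →
                1 ≤ m × Γ ⊢≈⟨ m ∸ 1 , e ⟩ t' ∶ L
↦m-decrements (rootm S u s) (app D D' r) =
  s≤s z≤n ,
  retarget (cong (λ k → plugS S (es u (wk k s))) (+-identityʳ (depthS S)))
           (↦m-typing S 0 D (exactly* D') r)

-- A derivation of C⟨u⟩ splits into a derivation
-- of u, in a context Δ that also covers the k = depthC C variables bound by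
-- C, and the contribution ΓC of the rest of C; the counters add up.

-- Δ seen from outside k binders.
dropC : ℕ → TCtx → TCtx
dropC k Δ y = Δ (k + y)

Agree : ℕ → TCtx → TCtx → Set
Agree k Δ Δ' = ∀ {y} → y < k → Δ' y ≈M Δ y

record HoleTyping (C : CCtx) (u : Tm) (Γ : TCtx) (m e : ℕ) (L : Lin) : Set where
  field
    Δ ΓC              : TCtx
    L₀                : Lin
    m₀ e₀ mC eC       : ℕ
    hole-typing       : Δ ⊢⟨ m₀ , e₀ ⟩ u ∶ L₀
    context-split     : Γ ≈C (dropC (depthC C) Δ ⊎ ΓC)
    m-split           : m ≡ mC + m₀
    e-split           : e ≡ eC + e₀
    refill            : ∀ {Δ' m₀' e₀' u'} → Agree (depthC C) Δ Δ' → Δ' ⊢≈⟨ m₀' , e₀' ⟩ u' ∶ L₀ →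
                        (dropC (depthC C) Δ' ⊎ ΓC) ⊢≈⟨ mC + m₀' , eC + e₀' ⟩ plugC C u' ∶ L

+-splitʳ : ∀ {a} b c d → a ≡ b + c → a + d ≡ (b + d) + c
+-splitʳ b c d ≡-refl = +-rightComm b c d

tl-dropC-⊎ : ∀ k Δ Γ Π → (tl (dropC k Δ ⊎ Γ) ⊎ Π) ≈C (dropC (suc k) Δ ⊎ (tl Γ ⊎ Π))
tl-dropC-⊎ k Δ Γ Π =
  ≈C-trans (⊎-congʳ {Π} (⊎-congʳ {tl Γ} (≈C-pointwise (λ y → cong Δ (+-suc k y)))))
           (⊎-assoc (dropC (suc k) Δ) (tl Γ) Π)

decompose : ∀ C {Γ m e u L} → Γ ⊢⟨ m , e ⟩ plugC C u ∶ L → HoleTyping C u Γ m e L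
decompose hole {Γ} {m} {e} {L = L} D = record
  { Δ = Γ ; ΓC = ∅ ; L₀ = L ; m₀ = m ; e₀ = e ; mC = 0 ; eC = 0
  ; hole-typing   = D
  ; context-split = ≈C-sym (⊎-identityʳ Γ)
  ; m-split       = ≡-refl
  ; e-split       = ≡-refl
  ; refill        = λ _ D' → ≈-resp (≈C-sym (⊎-identityʳ _)) (≈L-refl L) D'
  }
decompose (appL C v) (app {Π = Π} {m' = m'} {e' = e'} D D' r) = record
  { Δ = Δ ; ΓC = ΓC ⊎ Π ; L₀ = L₀ ; m₀ = m₀ ; e₀ = e₀ ; mC = suc (mC + m') ; eC = eC + e'
  ; hole-typing   = hole-typing
  ; context-split = ≈C-trans (⊎-congʳ {Π} context-split) (⊎-assoc _ ΓC Π)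
  ; m-split       = cong suc (+-splitʳ mC m₀ m' m-split)
  ; e-split       = +-splitʳ eC e₀ e' e-split
  ; refill        = λ agree D₀ →
      recount (cong suc (+-rightComm mC _ m')) (+-rightComm eC _ e')
        (≈-resp (⊎-assoc _ ΓC Π) (≈L-refl _) (≈app (refill agree D₀) (exactly* D') r))
  }
  where open HoleTyping (decompose C D)
decompose (sub C v) (esub {Π = Π} {m' = m'} {e' = e'} D D' r) = record
  { Δ = Δ ; ΓC = tl ΓC ⊎ Π ; L₀ = L₀ ; m₀ = m₀ ; e₀ = e₀ ; mC = mC + m' ; eC = eC + e'
  ; hole-typing   = hole-typing
  ; context-split = ≈C-trans (⊎-congʳ {Π} (tl-cong context-split)) (tl-dropC-⊎ k Δ ΓC Π)
  ; m-split       = +-splitʳ mC m₀ m' m-split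
  ; e-split       = +-splitʳ eC e₀ e' e-split
  ; refill        = λ {Δ'} agree D₀ →
      recount (+-rightComm mC _ m') (+-rightComm eC _ e')
        (≈-resp (tl-dropC-⊎ k Δ' ΓC Π) (≈L-refl _)
          (≈esub (refill (λ y<k → agree (m≤n⇒m≤1+n y<k)) D₀) (exactly* D')
            (↭-trans (++⁺ (agree (s≤s (≤-reflexive (+-identityʳ k)))) (≈M-refl (ΓC 0)))
                     (↭-trans (↭-sym (context-split 0)) r))))
  }
  where
  open HoleTyping (decompose C D)
  k = depthC C

-- For an occurrence of the variable k under a CbN context of depth k: its
-- axiom context x : [L] and the context of a term weakened by k + 1 are both
-- empty on the k bound variables, and seen from outside C they are [L] and
-- empty at the substituted variable 0.
fresh-agree : ∀ k {Π L} → Agree k (single k L) (gapC (suc k) Π)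
fresh-agree (suc k) {y = zero}  _         = ≈M-refl []
fresh-agree (suc k) {y = suc y} (s≤s y<k) = fresh-agree k y<k

dropC-single : ∀ k {L} → dropC k (single k L) ≈C single 0 L
dropC-single zero    = ≈C-refl
dropC-single (suc k) = dropC-single k

dropC-gapC : ∀ k {Π} → dropC k (gapC (suc k) Π) ≈C gapC 1 Π
dropC-gapC zero    = ≈C-refl
dropC-gapC (suc k) = dropC-gapC k

decrement-suc : ∀ {n n'} → n ≡ suc n' → 1 ≤ n × n ∸ 1 ≡ n'
decrement-suc ≡-refl = s≤s z≤n , ≡-refl

decrement-+ : ∀ {n} a {b} → n ≡ a + b → 1 ≤ b → 1 ≤ n × n ∸ 1 ≡ a + (b ∸ 1)
decrement-+ a ≡-refl 1≤b = m≤n⇒m≤o+n a 1≤b , +-∸-assoc a 1≤b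

-- Exponential bookkeeping: the variable occurrence had counters (0 , 1).
m-after-↦e : ∀ a b c → (a + b) + c ≡ (a + 0) + (b + c)
m-after-↦e = solve-∀

e-after-↦e : ∀ a b c → (a + 1) + (b + c) ≡ suc ((a + b) + c)
e-after-↦e = solve-∀

-- The occurrence of x
-- is typed by an axiom x : [L₀]; the multi type of x, hence of the argument
-- t, contains L₀, so the many-derivation of t splits off a derivation of t
-- at L₀.  Weakened past C and x, it replaces the axiom; the rest of t's
-- derivation types the remaining explicit substitution.
↦e-decrements : ∀ {Γ m e t t' L} → t ↦e t' → Γ ⊢⟨ m , e ⟩ t ∶ L →
                1 ≤ e × Γ ⊢≈⟨ m , e ∸ 1 ⟩ t' ∶ L
↦e-decrements (roote C t) (esub {Γ = Γ₁} {Π = Π} D D' r) with decompose C D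
... | record { ΓC = ΓC ; mC = mC ; eC = eC ; hole-typing = ax _ L₀
             ; context-split = split ; m-split = ≡-refl ; e-split = ≡-refl ; refill = refill }
  with permute* D' ≋-refl
         (↭-trans (↭-sym r) (↭-trans (split 0) (++⁺ (dropC-single (depthC C) 0) (≈M-refl (ΓC 0)))))
... | _ , _ , Π≈ , qa ∷ qr , more {Γ = Πa} {Π = Πb} {m = ma} {e = ea} {m' = mb} {e' = eb} Da Db =
  let (1≤e , e∸1) = decrement-suc (e-after-↦e eC ea eb) in
  1≤e ,
  recount (m-after-↦e mC ma mb) (≡-sym e∸1)
    (≈-resp context (≈L-refl _)
      (≈esub (refill (fresh-agree k) (≈-resp ≈C-refl qa (weaken Da (suc k) 0)))
             (exactly* Db)
             (↭-trans (++⁺ (dropC-gapC k 0) (≈M-refl (ΓC 0))) (↭-sym (refl qr)))))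
  where
  k = depthC C
  context : (tl (dropC k (gapC (suc k) Πa) ⊎ ΓC) ⊎ Πb) ≈C (tl Γ₁ ⊎ Π)
  context = begin
    tl (dropC k (gapC (suc k) Πa) ⊎ ΓC) ⊎ Πb ≈⟨ ⊎-congʳ {Πb} (tl-cong (⊎-congʳ {ΓC} (dropC-gapC k))) ⟩
    (Πa ⊎ tl ΓC) ⊎ Πb                        ≈⟨ ⊎-rotate Πa (tl ΓC) Πb ⟩
    tl ΓC ⊎ (Πa ⊎ Πb)                        ≈⟨ ⊎-cong (tl-cong (≈C-trans (⊎-congʳ {ΓC} (≈C-sym (dropC-single k)))
                                                                           (≈C-sym split)))
                                                       Π≈ ⟩
    tl Γ₁ ⊎ Π                                ∎
    where open import Relation.Binary.Reasoning.Setoid ctxSetoid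

replace-hole : ∀ C {Γ m e u u' L} (H : Γ ⊢⟨ m , e ⟩ plugC C u ∶ L) →
               let open HoleTyping (decompose C H) in
               ∀ {m₀' e₀'} → Δ ⊢≈⟨ m₀' , e₀' ⟩ u' ∶ L₀ → Γ ⊢≈⟨ mC + m₀' , eC + e₀' ⟩ plugC C u' ∶ L
replace-hole C H D₀ =
  ≈-resp (≈C-sym context-split) (≈L-refl _) (refill (λ {y} _ → ≈M-refl (Δ y)) D₀)
  where open HoleTyping (decompose C H)

m-closure : ∀ C {t t' Γ m e L} →
            (∀ {Δ m e L} → Δ ⊢⟨ m , e ⟩ t ∶ L → 1 ≤ m × Δ ⊢≈⟨ m ∸ 1 , e ⟩ t' ∶ L) →
            Γ ⊢⟨ m , e ⟩ plugC C t ∶ L → 1 ≤ m × Γ ⊢≈⟨ m ∸ 1 , e ⟩ plugC C t' ∶ L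
m-closure C step H =
  let open HoleTyping (decompose C H)
      (1≤m₀ , D₀)  = step hole-typing
      (1≤m , m∸1) = decrement-+ mC m-split 1≤m₀
  in 1≤m , recount (≡-sym m∸1) (≡-sym e-split) (replace-hole C H D₀)

e-closure : ∀ C {t t' Γ m e L} →
            (∀ {Δ m e L} → Δ ⊢⟨ m , e ⟩ t ∶ L → 1 ≤ e × Δ ⊢≈⟨ m , e ∸ 1 ⟩ t' ∶ L) →
            Γ ⊢⟨ m , e ⟩ plugC C t ∶ L → 1 ≤ e × Γ ⊢≈⟨ m , e ∸ 1 ⟩ plugC C t' ∶ L
e-closure C step H =
  let open HoleTyping (decompose C H)
      (1≤e₀ , D₀)  = step hole-typing
      (1≤e , e∸1) = decrement-+ eC e-split 1≤e₀
  in 1≤e , recount (≡-sym m-split) (≡-sym e∸1) (replace-hole C H D₀)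

proposition2 : ∀ {Γ m e t L} → Γ ⊢⟨ m , e ⟩ t ∶ L →
    (∀ {s} → t →m s →
      (1 ≤ m) × ∃₂ λ Γ' L' → Γ' ≈C Γ × L' ≈L L × Γ' ⊢⟨ m ∸ 1 , e ⟩ s ∶ L')
    × (∀ {s} → t →e s →
      (1 ≤ e) × ∃₂ λ Γ' L' → Γ' ≈C Γ × L' ≈L L × Γ' ⊢⟨ m , e ∸ 1 ⟩ s ∶ L')
proposition2 D =
  (λ { (ctxm C r) → m-closure C (↦m-decrements r) D }) ,
  (λ { (ctxe C r) → e-closure C (↦e-decrements r) D })
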